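{- If $H$ is a connected graph of order at least $3$, then $K_2 \,\square\, H$ is not well-dominated.
   Context: All graphs are finite, simple and undirected. $\gamma(X)$ is the minimum size of a dominating set (a set $D$ with every vertex in $D$ or adjacent to a vertex of $D$), $\Gamma(X)$ the maximum size of an inclusion-minimal dominating set; $X$ is well-dominated if $\gamma(X)=\Gamma(X)$. The Cartesian product $G\,\square\, H$ has vertex set $V(G)\times V(H)$, with $(g_1,h_1)\sim(g_2,h_2)$ iff either $g_1=g_2$ and $h_1h_2\in E(H)$, or $h_1=h_2$ and $g_1g_2\in E(G)$. $K_2$ is the complete graph on $2$ vertices. -}

module Defs where

open import Data.Nat using (ℕ; _≤_; _*_)
open import Data.Fin using (Fin; quotRem)
open import Data.Fin.Subset using (Subset; _∈_; _∉_; _⊂_; ∣_∣)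
open import Data.Product using (Σ; ∃; _×_; _,_; proj₁; proj₂)
open import Data.Sum using (_⊎_; inj₁; inj₂)
import Relation.Binary.PropositionalEquality as Eq
open import Relation.Nullary using (¬_)
open import Relation.Binary.PropositionalEquality using (_≡_; _≢_)

record Graph (n : ℕ) : Set₁ where
  field
    Adj   : Fin n → Fin n → Set
    irrefl : ∀ {u} → ¬ Adj u u
    sym    : ∀ {u v} → Adj u v → Adj v u
open Graph public

K : (n : ℕ) → Graph n
K n = record { Adj = λ u v → u ≢ v ; irrefl = λ p → p _≡_.refl ; sym = λ p q → p (Eq.sym q) }

data Walk {n : ℕ} (G : Graph n) : Fin n → Fin n → Set where
  here : ∀ {u} → Walk G u u
  step : ∀ {u v w} → Adj G u v → Walk G v w → Walk G u w

Connected : ∀ {n} → Graph n → Set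
Connected {n} G = ∀ (u v : Fin n) → Walk G u v

-- Cartesian product. Vertex set Fin (m * n) encodes Fin m × Fin n via
-- Data.Fin.combine / quotRem (quotRem n (combine g h) ≡ (h , g)).
fstV : ∀ {m} n → Fin (m * n) → Fin m
fstV {m} n x = proj₂ (quotRem {m} n x)

sndV : ∀ {m} n → Fin (m * n) → Fin n
sndV {m} n x = proj₁ (quotRem {m} n x)

ProdAdj : ∀ {m n} → Graph m → Graph n → Fin (m * n) → Fin (m * n) → Set
ProdAdj {m} {n} G H x y =
    (fstV {m} n x ≡ fstV {m} n y × Adj H (sndV {m} n x) (sndV {m} n y))
  ⊎ (sndV {m} n x ≡ sndV {m} n y × Adj G (fstV {m} n x) (fstV {m} n y))

_□_ : ∀ {m n} → Graph m → Graph n → Graph (m * n)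
_□_ {m} {n} G H = record { Adj = ProdAdj G H ; irrefl = irr ; sym = sy }
  where
  irr : ∀ {u} → ¬ ProdAdj G H u u
  irr (inj₁ (_ , a)) = irrefl H a
  irr (inj₂ (_ , a)) = irrefl G a
  sy : ∀ {u v} → ProdAdj G H u v → ProdAdj G H v u
  sy (inj₁ (e , a)) = inj₁ (Eq.sym e , Graph.sym H a)
  sy (inj₂ (e , a)) = inj₂ (Eq.sym e , Graph.sym G a)

Dominating : ∀ {n} → Graph n → Subset n → Set
Dominating {n} G D = ∀ (v : Fin n) → v ∈ D ⊎ ∃ λ u → u ∈ D × Adj G u v

MinimalDominating : ∀ {n} → Graph n → Subset n → Set
MinimalDominating G D = Dominating G D × (∀ D′ → D′ ⊂ D → ¬ Dominating G D′)

IsDominationNumber : ∀ {n} → Graph n → ℕ → Set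
IsDominationNumber G k =
  (∃ λ D → Dominating G D × ∣ D ∣ ≡ k) × (∀ D → Dominating G D → k ≤ ∣ D ∣)

IsUpperDominationNumber : ∀ {n} → Graph n → ℕ → Set
IsUpperDominationNumber G k =
  (∃ λ D → MinimalDominating G D × ∣ D ∣ ≡ k) × (∀ D → MinimalDominating G D → ∣ D ∣ ≤ k)

WellDominated : ∀ {n} → Graph n → Set
WellDominated G = ∃ λ k → IsDominationNumber G k × IsUpperDominationNumber G k

module Submission where

-- The bottom layer {0} × V(H) of K₂ □ H is a minimal dominating set, because (0,h) is the only
-- vertex of that layer dominating (1,h). Since H is connected with at least three vertices it
-- contains a path a – b – c, and exchanging (0,b) and (0,c) for the single vertex (1,c) still
-- dominates: (0,b) by (0,a), and (0,c) and (1,b) by (1,c). So γ(K₂ □ H) < Γ(K₂ □ H).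

open import Defs hiding (sym)
open import Data.Nat using (ℕ; suc; _+_; _*_; _≤_; _<_; z≤n; s≤s)
open import Data.Nat.Properties using (≤-trans; ≤-reflexive; <⇒≱; +-suc; +-comm; +-monoʳ-≤; module ≤-Reasoning)
open import Data.Fin using (Fin; zero; suc; combine; _≟_)
open import Data.Fin.Properties using (remQuot-combine; combine-remQuot; combine-injectiveˡ; combine-injectiveʳ)
open import Data.Fin.Subset using (Subset; inside; outside; _∈_; _⊂_; _∪_; _-_; ⁅_⁆; ∣_∣)
open import Data.Fin.Subset.Properties using (∣p∣≤∣x∷p∣; ∣⁅x⁆∣≡1; x∈⁅x⁆; x∈p∪q⁺; x∈p∧x≢y⇒x∈p-y; x∈p⇒∣p-x∣<∣p∣)
open import Data.Vec using ([]; _∷_; tabulate)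
open import Data.Vec.Properties using (lookup∘tabulate; []=⇒lookup; lookup⇒[]=)
open import Data.Product using (∃; ∃₂; _×_; _,_; proj₁; proj₂)
open import Data.Sum using (_⊎_; inj₁; inj₂; [_,_])
open import Relation.Nullary using (¬_; Dec; yes; no; does; proof; contradiction)
open import Function using (_∘_)
open import Relation.Nullary.Decidable using (dec-true; _⊎-dec_)
open import Relation.Nullary.Reflects using (Reflects; invert)
open import Relation.Binary.PropositionalEquality using (_≡_; _≢_; refl; sym; trans; cong; subst; subst₂)

∣p∪q∣≤∣p∣+∣q∣ : ∀ {n} (p q : Subset n) → ∣ p ∪ q ∣ ≤ ∣ p ∣ + ∣ q ∣
∣p∪q∣≤∣p∣+∣q∣ []            []            = z≤n
∣p∪q∣≤∣p∣+∣q∣ (inside ∷ p)  (s ∷ q)       =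
  s≤s (≤-trans (∣p∪q∣≤∣p∣+∣q∣ p q) (+-monoʳ-≤ ∣ p ∣ (∣p∣≤∣x∷p∣ s q)))
∣p∪q∣≤∣p∣+∣q∣ (outside ∷ p) (inside ∷ q)  =
  ≤-trans (s≤s (∣p∪q∣≤∣p∣+∣q∣ p q)) (≤-reflexive (sym (+-suc ∣ p ∣ ∣ q ∣)))
∣p∪q∣≤∣p∣+∣q∣ (outside ∷ p) (outside ∷ q) = ∣p∪q∣≤∣p∣+∣q∣ p q

module _ {k} {P : Fin k → Set} (P? : ∀ x → Dec (P x)) where

  fromDec : Subset k
  fromDec = tabulate (does ∘ P?)

  ∈fromDec⁺ : ∀ {x} → P x → x ∈ fromDec
  ∈fromDec⁺ {x} p = lookup⇒[]= x fromDec (trans (lookup∘tabulate _ x) (dec-true (P? x) p))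

  ∈fromDec⁻ : ∀ {x} → x ∈ fromDec → P x
  ∈fromDec⁻ {x} x∈ = invert (subst (Reflects (P x)) (trans (sym (lookup∘tabulate _ x)) ([]=⇒lookup x∈)) (proof (P? x)))

avoid-zero-and : ∀ {n} (b : Fin (suc (suc (suc n)))) → ∃ λ c → c ≢ zero × c ≢ b
avoid-zero-and b with b ≟ suc zero
... | yes refl = suc (suc zero) , (λ ()) , (λ ())
... | no b≢1   = suc zero , (λ ()) , b≢1 ∘ sym

module _ {n} (G : Graph n) where

  walk-crossing : (P : Fin n → Set) → (∀ v → Dec (P v)) → ∀ {u w} → Walk G u w → P u → ¬ P w
                → ∃₂ λ x y → P x × ¬ P y × Adj G x y
  walk-crossing P P? here                 Pu ¬Pw = contradiction Pu ¬Pw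
  walk-crossing P P? (step {v = v} e walk) Pu ¬Pw with P? v
  ... | yes Pv = walk-crossing P P? walk Pv ¬Pw
  ... | no ¬Pv = _ , v , Pu , ¬Pv , e

  PrivateNeighbour : Subset n → Fin n → Fin n → Set
  PrivateNeighbour D x v = ∀ {u} → u ∈ D → u ≡ v ⊎ Adj G u v → u ≡ x

  privateNeighbours⇒minimal : ∀ {D} → Dominating G D
    → (∀ {x} → x ∈ D → ∃ (PrivateNeighbour D x)) → MinimalDominating G D
  privateNeighbours⇒minimal {D} dom hasPrivate = dom , shrink-fails
    where
    shrink-fails : ∀ D′ → D′ ⊂ D → ¬ Dominating G D′
    shrink-fails D′ (D′⊆D , x , x∈D , x∉D′) dom′ with hasPrivate x∈D
    ... | v , only-x with dom′ v
    ...   | inj₁ v∈D′           = x∉D′ (subst (_∈ D′) (only-x (D′⊆D v∈D′) (inj₁ refl)) v∈D′)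
    ...   | inj₂ (u , u∈D′ , e) = x∉D′ (subst (_∈ D′) (only-x (D′⊆D u∈D′) (inj₂ e)) u∈D′)

  wellDominated⇒minimal≤dominating : WellDominated G → ∀ {D D′} → MinimalDominating G D → Dominating G D′
    → ∣ D ∣ ≤ ∣ D′ ∣
  wellDominated⇒minimal≤dominating (_ , (_ , γ≤) , (_ , ≤Γ)) min dom = ≤-trans (≤Γ _ min) (γ≤ _ dom)

  record Path₃ : Set where
    field
      {a b c} : Fin n
      ab  : Adj G a b
      bc  : Adj G b c
      a≢c : a ≢ c

  adj⇒≢ : ∀ {u v} → Adj G u v → u ≢ v
  adj⇒≢ e refl = irrefl G e

  -- A walk from 0 to 1 leaves {0} along an edge 0 – b; a walk from 0 to a third vertex then
  -- leaves {0, b}, and the edge it leaves along extends 0 – b to a path.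
  connected⇒path₃ : 3 ≤ n → Connected G → Path₃
  connected⇒path₃ (s≤s (s≤s (s≤s z≤n))) conn
    with walk-crossing (_≡ zero) (_≟ zero) (conn zero (suc zero)) refl (λ ())
  ... | _ , b , refl , _ , 0b with avoid-zero-and b
  ... | c , c≢0 , c≢b
    with walk-crossing (λ v → v ≡ zero ⊎ v ≡ b) (λ v → v ≟ zero ⊎-dec v ≟ b) (conn zero c) (inj₁ refl)
           [ c≢0 , c≢b ]
  ...   | _ , y , inj₁ refl , y∉ , 0y = record { ab = Graph.sym G 0b ; bc = 0y ; a≢c = λ b≡y → y∉ (inj₂ (sym b≡y)) }
  ...   | _ , y , inj₂ refl , y∉ , by = record { ab = 0b ; bc = by ; a≢c = λ 0≡y → y∉ (inj₁ (sym 0≡y)) }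

module _ {m n} (G : Graph m) (H : Graph n) where

  data Pairing : Fin (m * n) → Set where
    ⟨_,_⟩ : (i : Fin m) (h : Fin n) → Pairing (combine i h)

  pairing : ∀ x → Pairing x
  pairing x = subst Pairing (combine-remQuot {m} n x) ⟨ _ , _ ⟩

  fstV-combine : ∀ i h → fstV {m} n (combine i h) ≡ i
  fstV-combine i h = cong proj₁ (remQuot-combine {m} {n} i h)

  sndV-combine : ∀ i h → sndV {m} n (combine i h) ≡ h
  sndV-combine i h = cong proj₂ (remQuot-combine {m} {n} i h)

  □-adjʳ : ∀ {i h h′} → Adj H h h′ → Adj (G □ H) (combine i h) (combine i h′)
  □-adjʳ {i} {h} {h′} e =
    inj₁ (trans (fstV-combine i h) (sym (fstV-combine i h′)) ,
          subst₂ (Adj H) (sym (sndV-combine i h)) (sym (sndV-combine i h′)) e)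

  □-adjˡ : ∀ {i i′ h} → Adj G i i′ → Adj (G □ H) (combine i h) (combine i′ h)
  □-adjˡ {i} {i′} {h} e =
    inj₂ (trans (sndV-combine i h) (sym (sndV-combine i′ h)) ,
          subst₂ (Adj G) (sym (fstV-combine i h)) (sym (fstV-combine i′ h)) e)

  □-adj⁻ : ∀ {i i′ h h′} → Adj (G □ H) (combine i h) (combine i′ h′)
         → i ≡ i′ × Adj H h h′ ⊎ h ≡ h′ × Adj G i i′
  □-adj⁻ {i} {i′} {h} {h′} (inj₁ (i≡i′ , e)) =
    inj₁ (trans (sym (fstV-combine i h)) (trans i≡i′ (fstV-combine i′ h′)) ,
          subst₂ (Adj H) (sndV-combine i h) (sndV-combine i′ h′) e)
  □-adj⁻ {i} {i′} {h} {h′} (inj₂ (h≡h′ , e)) =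
    inj₂ (trans (sym (sndV-combine i h)) (trans h≡h′ (sndV-combine i′ h′)) ,
          subst₂ (Adj G) (fstV-combine i h) (fstV-combine i′ h′) e)

  layer : Fin m → Subset (m * n)
  layer i = fromDec (λ x → fstV {m} n x ≟ i)

  combine∈layer : ∀ i h → combine i h ∈ layer i
  combine∈layer i h = ∈fromDec⁺ (λ x → fstV {m} n x ≟ i) (fstV-combine i h)

  combine∈layer⁻ : ∀ {i j h} → combine i h ∈ layer j → i ≡ j
  combine∈layer⁻ {i} {j} {h} i∈ = trans (sym (fstV-combine i h)) (∈fromDec⁻ (λ x → fstV {m} n x ≟ j) i∈)

  layer-minimalDominating : ∀ {i j} → (∀ {k} → k ≢ i → Adj G i k) → j ≢ i → MinimalDominating (G □ H) (layer i)
  layer-minimalDominating {i} {j} universal j≢i = privateNeighbours⇒minimal (G □ H) dominating privateNeighbour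
    where
    dominating : Dominating (G □ H) (layer i)
    dominating v with pairing v
    ... | ⟨ k , h ⟩ with k ≟ i
    ...   | yes refl = inj₁ (combine∈layer k h)
    ...   | no k≢i   = inj₂ (combine i h , combine∈layer i h , □-adjˡ (universal k≢i))

    privateNeighbour : ∀ {x} → x ∈ layer i → ∃ (PrivateNeighbour (G □ H) (layer i) x)
    privateNeighbour {x} x∈ with pairing x
    ... | ⟨ k , h ⟩ with refl ← combine∈layer⁻ x∈ = combine j h , only-from-x
      where
      only-from-x : PrivateNeighbour (G □ H) (layer i) (combine i h) (combine j h)
      only-from-x {u} u∈ u-dominates with pairing u
      ... | ⟨ l , h′ ⟩ with refl ← combine∈layer⁻ u∈ with u-dominates
      ... | inj₁ u≡v = contradiction (sym (combine-injectiveˡ i h′ j h u≡v)) j≢i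
      ... | inj₂ u~v with □-adj⁻ u~v
      ...   | inj₁ (i≡j , _) = contradiction (sym i≡j) j≢i
      ...   | inj₂ (refl , _) = refl

module Exchange {n} (H : Graph n) (path : Path₃ H) where
  open Path₃ path

  vertex : Fin 2 → Fin n → Fin (2 * n)
  vertex = combine

  bottom : Subset (2 * n)
  bottom = layer (K 2) H zero

  b₀ c₀ c₁ : Fin (2 * n)
  b₀ = vertex zero b
  c₀ = vertex zero c
  c₁ = vertex (suc zero) c

  exchanged : Subset (2 * n)
  exchanged = (bottom - b₀ - c₀) ∪ ⁅ c₁ ⁆

  c₁∈exchanged : c₁ ∈ exchanged
  c₁∈exchanged = x∈p∪q⁺ (inj₂ (x∈⁅x⁆ c₁))

  vertex₀∈exchanged : ∀ {h} → h ≢ b → h ≢ c → vertex zero h ∈ exchanged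
  vertex₀∈exchanged {h} h≢b h≢c = x∈p∪q⁺ (inj₁
    (x∈p∧x≢y⇒x∈p-y (x∈p∧x≢y⇒x∈p-y (combine∈layer (K 2) H zero h) (h≢b ∘ combine-injectiveʳ {2} zero h zero b))
                                                                  (h≢c ∘ combine-injectiveʳ {2} zero h zero c)))

  exchanged-dominating : Dominating (K 2 □ H) exchanged
  exchanged-dominating v with pairing (K 2) H v
  ... | ⟨ i , h ⟩ with i | h ≟ b | h ≟ c
  ... | zero     | yes refl | _        = inj₂ (vertex zero a , vertex₀∈exchanged (adj⇒≢ H ab) a≢c , □-adjʳ (K 2) H {zero} ab)
  ... | zero     | no _     | yes refl = inj₂ (c₁ , c₁∈exchanged , □-adjˡ (K 2) H {suc zero} {zero} (λ ()))
  ... | zero     | no h≢b   | no h≢c   = inj₁ (vertex₀∈exchanged h≢b h≢c)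
  ... | suc zero | _        | yes refl = inj₁ c₁∈exchanged
  ... | suc zero | yes refl | no _     = inj₂ (c₁ , c₁∈exchanged , □-adjʳ (K 2) H {suc zero} (Graph.sym H bc))
  ... | suc zero | no h≢b   | no h≢c   = inj₂ (vertex zero h , vertex₀∈exchanged h≢b h≢c , □-adjˡ (K 2) H {zero} {suc zero} (λ ()))

  ∣exchanged∣<∣bottom∣ : ∣ exchanged ∣ < ∣ bottom ∣
  ∣exchanged∣<∣bottom∣ = begin-strict
    ∣ exchanged ∣                      ≤⟨ ∣p∪q∣≤∣p∣+∣q∣ (bottom - b₀ - c₀) ⁅ c₁ ⁆ ⟩
    ∣ bottom - b₀ - c₀ ∣ + ∣ ⁅ c₁ ⁆ ∣  ≡⟨ cong (∣ bottom - b₀ - c₀ ∣ +_) (∣⁅x⁆∣≡1 c₁) ⟩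
    ∣ bottom - b₀ - c₀ ∣ + 1          ≡⟨ +-comm ∣ bottom - b₀ - c₀ ∣ 1 ⟩
    suc ∣ bottom - b₀ - c₀ ∣          ≤⟨ x∈p⇒∣p-x∣<∣p∣ c₀∈bottom-b₀ ⟩
    ∣ bottom - b₀ ∣                   <⟨ x∈p⇒∣p-x∣<∣p∣ (combine∈layer (K 2) H zero b) ⟩
    ∣ bottom ∣                        ∎
    where
    open ≤-Reasoning
    c₀∈bottom-b₀ : c₀ ∈ bottom - b₀
    c₀∈bottom-b₀ = x∈p∧x≢y⇒x∈p-y (combine∈layer (K 2) H zero c) (adj⇒≢ H bc ∘ sym ∘ combine-injectiveʳ {2} zero c zero b)

  bottom-minimalDominating : MinimalDominating (K 2 □ H) bottom
  bottom-minimalDominating = layer-minimalDominating (K 2) H {zero} {suc zero} (λ k≢0 0≡k → k≢0 (sym 0≡k)) (λ ())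

proposition6 : (n : ℕ) → (H : Graph n) → 3 ≤ n → Connected H
    → ¬ WellDominated (K 2 □ H)
proposition6 n H n≥3 connected wellDominated =
  <⇒≱ ∣exchanged∣<∣bottom∣
      (wellDominated⇒minimal≤dominating (K 2 □ H) wellDominated bottom-minimalDominating exchanged-dominating)
  where open Exchange H (connected⇒path₃ H n≥3 connected)
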